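{- Fix a prime $p \ge 7$ and one of the six hypergeometric data described in the context, with the labelling $r_1,\dots,r_4$, $q_1,\dots,q_4$, $t_j$, $u_j$ and the function $\Lambda$ defined there. Let $0\le a\le p-1$ and $b\ge 0$ be integers. If either $a\le u_2$ or $b\not\equiv -q_2' \pmod p$, then \[ \left(1+\frac{b}{q_1'}\right)\Lambda(a+bp)\in\mathbb{Z}_p. \]
   Context: Let $(r,r^\ast,q)$ be one of $\left(\tfrac12,\tfrac12,\tfrac43\right), \left(\tfrac12,\tfrac12,\tfrac76\right), \left(\tfrac12,\tfrac13,\tfrac76\right), \left(\tfrac12,\tfrac13,\tfrac54\right), \left(\tfrac12,\tfrac14,\tfrac76\right), \left(\tfrac12,\tfrac12,\tfrac54\right)$, and $\alpha=\{r,1-r,r^\ast,1-r^\ast\}$, $\beta=\{1,1,q,2-q\}$ (multisets). For $x\in\mathbb{Q}\cap\mathbb{Z}_p$ let $[x]_0\in\{0,\dots,p-1\}$ be its first $p$-adic digit and $x'=(x+[-x]_0)/p$. Label $\alpha=\{r_1,r_2,r_3,r_4\}$ and $\beta=\{q_1,q_2,q_3,q_4\}$ so that $r_1'\le r_2'\le r_3'\le r_4'$ and $q_1'\le q_2'\le q_3'\le q_4'$ (then $q_3=q_4=1$). Set $t_j=[-r_j]_0$, $u_j=[-q_j]_0$. For integers $0\le a,x\le p-1$ let $\nu(a,x)=0$ if $a\le x$ and $\nu(a,x)=1$ if $x<a$. For integers $0\le a\le p-1$, $b\ge 0$ define \[ \Lambda(a+bp)=\prod_{j=1}^4\left(1+\frac{b}{r_j'}\right)^{\nu(a,t_j)}\left(1+\frac{b}{q_j'}\right)^{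 -\nu(a,u_j)}. \] -}

module Defs where

open import Data.Bool using (Bool; true; false; if_then_else_)
open import Data.Nat as ℕ using (ℕ; zero; suc)
open import Data.Nat.Divisibility using (_∣_; _∣?_)
open import Data.Integer as ℤ using (ℤ; +_)
open import Data.Rational as ℚ using (ℚ; 0ℚ; 1ℚ; ↥_; ↧ₙ_; _≤ᵇ_)
open import Data.Rational.Properties using (_≟_)
open import Data.Fin using (Fin; zero; suc)
open import Data.Vec using (Vec; []; _∷_; lookup)
open import Data.List using (List; []; _∷_; upTo)
open import Relation.Nullary using (yes; no; does; ¬_)

-- p-adic notions for rationals (Data.Rational's ℚ is in lowest terms)

-- x ∈ ℤ_p  :  p does not divide the (reduced) denominator of x
InZp : ℕ → ℚ → Set
InZp p x = ¬ (p ∣ ↧ₙ x)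

-- x ∈ pℤ_p (i.e. x ≡ 0 mod p in ℤ_p): p divides the reduced numerator
InPZp : ℕ → ℚ → Set
InPZp p x = p ∣ ℤ.∣ ↥ x ∣

fromℕ : ℕ → ℚ
fromℕ k = (+ k) ℚ./ 1

-- 1/p as a rational (totalised: value 0 at p = 0, never used since p ≥ 7)
recipℕ : ℕ → ℚ
recipℕ zero    = 0ℚ
recipℕ (suc n) = (+ 1) ℚ./ (suc n)

-- total inverse on ℚ (value 0 at 0; only applied to nonzero arguments)
inv : ℚ → ℚ
inv x with x ≟ 0ℚ
... | yes _  = 0ℚ
... | no x≢0 = ℚ.1/_ x {{ℚ.≢-nonZero x≢0}}

digitSearch : ℕ → ℤ → ℕ → List ℕ → ℕ
digitSearch p n d []       = 0
digitSearch p n d (k ∷ ks) =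
  if does (p ∣? ℤ.∣ n ℤ.- (+ k) ℤ.* (+ d) ∣) then k else digitSearch p n d ks

-- [x]_0 : the first p-adic digit of x ∈ ℚ ∩ ℤ_p, i.e. the unique
-- k ∈ {0,…,p-1} with x ≡ k (mod p ℤ_p)  (x = n/d, p ∤ d ⇔ p ∣ n - k d)
digit0 : ℕ → ℚ → ℕ
digit0 p x = digitSearch p (↥ x) (↧ₙ x) (upTo p)

-- Dwork prime  x' = (x + [-x]_0) / p
dash : ℕ → ℚ → ℚ
dash p x = (x ℚ.+ fromℕ (digit0 p (ℚ.- x))) ℚ.* recipℕ p

insertBy : {n : ℕ} → (ℚ → ℚ) → ℚ → Vec ℚ n → Vec ℚ (suc n)
insertBy f x []       = x ∷ []
insertBy f x (y ∷ ys) = if f x ≤ᵇ f y then x ∷ y ∷ ys else y ∷ insertBy f x ys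

sortBy : {n : ℕ} → (ℚ → ℚ) → Vec ℚ n → Vec ℚ n
sortBy f []       = []
sortBy f (x ∷ xs) = insertBy f x (sortBy f xs)

data Datum : Set where
  d1 d2 d3 d4 d5 d6 : Datum

half third quarter : ℚ
half    = (+ 1) ℚ./ 2
third   = (+ 1) ℚ./ 3
quarter = (+ 1) ℚ./ 4

rOf rsOf qOf : Datum → ℚ
rOf _ = half
rsOf d1 = half
rsOf d2 = half
rsOf d3 = third
rsOf d4 = third
rsOf d5 = quarter
rsOf d6 = half
qOf d1 = (+ 4) ℚ./ 3
qOf d2 = (+ 7) ℚ./ 6
qOf d3 = (+ 7) ℚ./ 6
qOf d4 = (+ 5) ℚ./ 4
qOf d5 = (+ 7) ℚ./ 6
qOf d6 = (+ 5) ℚ./ 4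

alpha beta : Datum → Vec ℚ 4
alpha D = rOf D ∷ (1ℚ ℚ.- rOf D) ∷ rsOf D ∷ (1ℚ ℚ.- rsOf D) ∷ []
beta  D = 1ℚ ∷ 1ℚ ∷ qOf D ∷ (fromℕ 2 ℚ.- qOf D) ∷ []

rs qs : ℕ → Datum → Vec ℚ 4
rs p D = sortBy (dash p) (alpha D)
qs p D = sortBy (dash p) (beta D)

r_ q_ : ℕ → Datum → Fin 4 → ℚ
r_ p D j = lookup (rs p D) j
q_ p D j = lookup (qs p D) j

t_ u_ : ℕ → Datum → Fin 4 → ℕ
t_ p D j = digit0 p (ℚ.- r_ p D j)
u_ p D j = digit0 p (ℚ.- q_ p D j)

ν : ℕ → ℕ → ℕ
ν a x = if a ℕ.≤ᵇ x then 0 else 1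

pow : ℚ → ℕ → ℚ
pow x zero    = 1ℚ
pow x (suc n) = x ℚ.* pow x n

onePlus : ℕ → ℚ → ℚ
onePlus b y = 1ℚ ℚ.+ fromℕ b ℚ.* inv y

Λfactor : ℕ → Datum → ℕ → ℕ → Fin 4 → ℚ
Λfactor p D a b j =
  pow (onePlus b (dash p (r_ p D j))) (ν a (t_ p D j))
  ℚ.* inv (pow (onePlus b (dash p (q_ p D j))) (ν a (u_ p D j)))

-- Λ(a + b p) for 0 ≤ a ≤ p-1, b ≥ 0
Λ : ℕ → Datum → ℕ → ℕ → ℚ
Λ p D a b = Λfactor p D a b zero ℚ.* (Λfactor p D a b (suc zero) ℚ.*
            (Λfactor p D a b (suc (suc zero)) ℚ.* Λfactor p D a b (suc (suc (suc zero)))))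

module Submission where

-- The Dwork prime x′ of every entry x = n/d of α and β (1 ≤ n ≤ 7, d ≤ 6 < p) is a p-adic unit:
-- with k the first digit of −x, x′·d = (n + k·d)/p =: m is an integer with 0 < m ≤ d < p.  Hence
-- each factor (1 + b/r_j′)^ν(a,t_j) of Λ is p-integral.  Moreover m = d would force d ∣ n, so the
-- non-integers q and 2 − q have x′ < 1 = 1′, and the labelling puts q₃ = q₄ = 1; their digit is
-- u = p − 1 ≥ a, so ν(a,u₃) = ν(a,u₄) = 0.  The q₂ factor is trivial when a ≤ u₂ and otherwise the
-- inverse of the unit (b + q₂′)/q₂′.  Finally X = 1 + b/q₁′ times X^(−ν(a,u₁)) is X or X·X⁻¹,
-- which is 1 or (with the convention 0⁻¹ = 0) 0.

open import Defs
open import Data.Nat as ℕ using (ℕ; zero; suc; _≤_; _<_; z≤n; s≤s)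
import Data.Nat.Properties as ℕP
open import Data.Nat.DivMod using (_%_; _/_; m≡m%n+[m/n]*n; m%n<n)
open import Data.Nat.Divisibility
  using (_∣_; _∣?_; divides; _∣0; ∣-refl; ∣-trans; ∣1⇒≡1; ∣⇒≤; ∣m+n∣m⇒∣n; m∣m*n; n∣m*n)
open import Data.Nat.Coprimality as Coprimality using (Coprime)
open import Data.Nat.GCD using (module Bézout)
open import Data.Nat.Primality
  using (Prime; euclidsLemma; ¬prime[1]; prime⇒irreducible; prime⇒nonTrivial; prime⇒nonZero)
open import Data.Nat.Tactic.RingSolver as ℕSolver using ()
open import Data.Integer as ℤ using (ℤ; +_; -[1+_]; +[1+_])
import Data.Integer.Properties as ℤP
open import Data.Integer.Tactic.RingSolver as ℤSolver using ()
open import Data.Rational as ℚ using (ℚ; mkℚ; 0ℚ; 1ℚ; ↥_; ↧ₙ_; _+_; _*_; toℚᵘ)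
import Data.Rational.Properties as ℚP
open import Data.Rational.Unnormalised as ℚᵘ using (mkℚᵘ; *≡*; _≃_)
import Data.Rational.Unnormalised.Properties as ℚᵘP
open import Algebra.Bundles using (CommutativeRing)
open import Algebra.Properties.CommutativeSemigroup
  (CommutativeRing.*-commutativeSemigroup ℚP.+-*-commutativeRing) as ℚ*
open import Data.Bool using (T; true; false)
open import Data.Unit using (tt)
open import Data.Empty using (⊥-elim)
open import Data.Fin using (Fin; zero; suc)
open import Data.List using ([]; _∷_; upTo)
open import Data.List.Membership.Propositional using (_∈_)
open import Data.List.Membership.Propositional.Properties using (∈-upTo⁺; ∈-upTo⁻)
open import Data.List.Relation.Unary.Any using (here; there)
open import Data.Product using (∃-syntax; _×_; _,_; map; map₁; proj₁; proj₂)
open import Data.Vec using (Vec; []; _∷_; _∷ʳ_; lookup)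
open import Data.Vec.Relation.Unary.All as All using (All; []; _∷_; all?)
open import Data.Vec.Relation.Unary.All.Properties using (lookup⁺)
open import Data.Sum using (_⊎_; inj₁; inj₂; [_,_]′)
open import Relation.Binary.PropositionalEquality
open import Function using (case_of_)
open import Relation.Nullary using (¬_; yes; no; Dec)
open import Relation.Nullary.Decidable using (toWitness; _×-dec_)

fromℤ : ℤ → ℚ
fromℤ i = i ℚ./ 1

toℚᵘ-fromℤ : ∀ i → toℚᵘ (fromℤ i) ≃ mkℚᵘ i 0
toℚᵘ-fromℤ i = ℚP.toℚᵘ-fromℚᵘ (mkℚᵘ i 0)

fromℤ-* : ∀ i j → fromℤ (i ℤ.* j) ≡ fromℤ i * fromℤ j
fromℤ-* i j = ℚP.toℚᵘ-injective (begin
  toℚᵘ (fromℤ (i ℤ.* j))            ≈⟨ toℚᵘ-fromℤ (i ℤ.* j) ⟩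
  mkℚᵘ i 0 ℚᵘ.* mkℚᵘ j 0            ≈⟨ ℚᵘP.*-cong (toℚᵘ-fromℤ i) (toℚᵘ-fromℤ j) ⟨
  toℚᵘ (fromℤ i) ℚᵘ.* toℚᵘ (fromℤ j) ≈⟨ ℚP.toℚᵘ-homo-* (fromℤ i) (fromℤ j) ⟨
  toℚᵘ (fromℤ i * fromℤ j)          ∎)
  where open ℚᵘP.≃-Reasoning

fromℕ-* : ∀ m n → fromℕ (m ℕ.* n) ≡ fromℕ m * fromℕ n
fromℕ-* m n = trans (cong fromℤ (ℤP.pos-* m n)) (fromℤ-* (+ m) (+ n))

fromℤ-+ : ∀ i j → fromℤ (i ℤ.+ j) ≡ fromℤ i + fromℤ j
fromℤ-+ i j = ℚP.toℚᵘ-injective (begin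
  toℚᵘ (fromℤ (i ℤ.+ j))            ≈⟨ toℚᵘ-fromℤ (i ℤ.+ j) ⟩
  mkℚᵘ (i ℤ.+ j) 0                  ≈⟨ *≡* (cross-multiplied i j) ⟩
  mkℚᵘ i 0 ℚᵘ.+ mkℚᵘ j 0            ≈⟨ ℚᵘP.+-cong (toℚᵘ-fromℤ i) (toℚᵘ-fromℤ j) ⟨
  toℚᵘ (fromℤ i) ℚᵘ.+ toℚᵘ (fromℤ j) ≈⟨ ℚP.toℚᵘ-homo-+ (fromℤ i) (fromℤ j) ⟨
  toℚᵘ (fromℤ i + fromℤ j)          ∎)
  where
  open ℚᵘP.≃-Reasoning
  cross-multiplied : ∀ i j → (i ℤ.+ j) ℤ.* + 1 ≡ (i ℤ.* + 1 ℤ.+ j ℤ.* + 1) ℤ.* + 1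
  cross-multiplied = ℤSolver.solve-∀

fromℤ-injective : ∀ {i j} → fromℤ i ≡ fromℤ j → i ≡ j
fromℤ-injective {i} {j} eq with ℚᵘP.≃-trans (ℚᵘP.≃-sym (toℚᵘ-fromℤ i))
                                  (ℚᵘP.≃-trans (ℚᵘP.≃-reflexive (cong toℚᵘ eq)) (toℚᵘ-fromℤ j))
... | *≡* i*1≡j*1 = ℤP.*-cancelʳ-≡ i j (+ 1) i*1≡j*1

*-denominator : ∀ x → x * fromℕ (↧ₙ x) ≡ fromℤ (↥ x)
*-denominator x@(mkℚ n d _) = ℚP.toℚᵘ-injective (begin
  toℚᵘ (x * fromℕ (suc d))            ≈⟨ ℚP.toℚᵘ-homo-* x (fromℕ (suc d)) ⟩
  toℚᵘ x ℚᵘ.* toℚᵘ (fromℕ (suc d))    ≈⟨ ℚᵘP.*-congˡ {toℚᵘ x} (toℚᵘ-fromℤ (+ suc d)) ⟩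
  mkℚᵘ n d ℚᵘ.* mkℚᵘ (+ suc d) 0      ≈⟨ *≡* cross-multiplied ⟩
  mkℚᵘ n 0                            ≈⟨ toℚᵘ-fromℤ n ⟨
  toℚᵘ (fromℤ n)                      ∎)
  where
  open ℚᵘP.≃-Reasoning
  cross-multiplied : (n ℤ.* + suc d) ℤ.* + 1 ≡ n ℤ.* + suc (d ℕ.* 1)
  cross-multiplied rewrite ℕP.*-identityʳ d = ℤP.*-identityʳ _

*-fromℤ⇒cross : ∀ x {n d} → x * fromℤ d ≡ fromℤ n → ℤ.∣ ↥ x ∣ ℕ.* ℤ.∣ d ∣ ≡ ℤ.∣ n ∣ ℕ.* ↧ₙ x
*-fromℤ⇒cross x {n} {d} x*d≡n = begin
  ℤ.∣ ↥ x ∣ ℕ.* ℤ.∣ d ∣   ≡⟨ ℤP.abs-* (↥ x) d ⟨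
  ℤ.∣ ↥ x ℤ.* d ∣         ≡⟨ cong ℤ.∣_∣ (fromℤ-injective {↥ x ℤ.* d} {n ℤ.* ℚ.↧ x} in-ℚ) ⟩
  ℤ.∣ n ℤ.* ℚ.↧ x ∣       ≡⟨ ℤP.abs-* n (ℚ.↧ x) ⟩
  ℤ.∣ n ∣ ℕ.* ↧ₙ x        ∎
  where
  open ≡-Reasoning
  in-ℚ : fromℤ (↥ x ℤ.* d) ≡ fromℤ (n ℤ.* ℚ.↧ x)
  in-ℚ = begin
    fromℤ (↥ x ℤ.* d)                  ≡⟨ fromℤ-* (↥ x) d ⟩
    fromℤ (↥ x) * fromℤ d              ≡⟨ cong (_* fromℤ d) (*-denominator x) ⟨
    (x * fromℤ (ℚ.↧ x)) * fromℤ d      ≡⟨ ℚP.*-assoc x _ _ ⟩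
    x * (fromℤ (ℚ.↧ x) * fromℤ d)      ≡⟨ cong (x *_) (ℚP.*-comm _ (fromℤ d)) ⟩
    x * (fromℤ d * fromℤ (ℚ.↧ x))      ≡⟨ ℚP.*-assoc x _ _ ⟨
    (x * fromℤ d) * fromℤ (ℚ.↧ x)      ≡⟨ cong (_* fromℤ (ℚ.↧ x)) x*d≡n ⟩
    fromℤ n * fromℤ (ℚ.↧ x)            ≡⟨ fromℤ-* n (ℚ.↧ x) ⟨
    fromℤ (n ℤ.* ℚ.↧ x)                ∎

fromℕ*recipℕ : ∀ n .{{_ : ℕ.NonZero n}} → fromℕ n * recipℕ n ≡ 1ℚ
fromℕ*recipℕ (suc n) = ℚP.toℚᵘ-injective (begin
  toℚᵘ (fromℕ (suc n) * recipℕ (suc n))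
    ≈⟨ ℚP.toℚᵘ-homo-* (fromℕ (suc n)) (recipℕ (suc n)) ⟩
  toℚᵘ (fromℕ (suc n)) ℚᵘ.* toℚᵘ (recipℕ (suc n))
    ≈⟨ ℚᵘP.*-cong (toℚᵘ-fromℤ (+ suc n)) (ℚP.toℚᵘ-fromℚᵘ (mkℚᵘ (+ 1) n)) ⟩
  mkℚᵘ (+ suc n) 0 ℚᵘ.* mkℚᵘ (+ 1) n
    ≈⟨ *≡* (cong (λ z → + suc z) (cross-multiplied n)) ⟩
  toℚᵘ 1ℚ
    ∎)
  where
  open ℚᵘP.≃-Reasoning
  cross-multiplied : ∀ n → n ℕ.* 1 ℕ.* 1 ≡ n ℕ.+ 0 ℕ.+ 0 ℕ.* suc (n ℕ.+ 0)
  cross-multiplied = ℕSolver.solve-∀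

*-inv : ∀ {x} → x ≢ 0ℚ → x * inv x ≡ 1ℚ
*-inv {x} x≢0 with x ℚP.≟ 0ℚ
... | yes x≡0 = ⊥-elim (x≢0 x≡0)
... | no  _   = ℚP.*-inverseʳ x {{ℚ.≢-nonZero x≢0}}

BoundedFraction : ℚ → ℕ → Set
BoundedFraction y e = ∃[ m ] y * fromℕ e ≡ fromℕ m × 0 < m × m ≤ e × (m ≡ e → e ≡ 1)

*-fromℕ⇒<1 : ∀ y {e m} → y * fromℕ (suc e) ≡ fromℕ m → m < suc e → y ℚ.< 1ℚ
*-fromℕ⇒<1 y@(mkℚ (+ a) dy _) {e} {m} eq m<E =
  ℚ.*<* (subst₂ ℤ._<_ (sym (ℤP.*-identityʳ (+ a))) (sym (ℤP.*-identityˡ (+ suc dy))) (ℤ.+<+ a<D))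
  where
  open ℕP.≤-Reasoning
  a<D : a < suc dy
  a<D = ℕP.*-cancelʳ-< (suc e) a (suc dy) (begin-strict
    a ℕ.* suc e       ≡⟨ *-fromℤ⇒cross y {+ m} {+ suc e} eq ⟩
    m ℕ.* suc dy      <⟨ ℕP.*-monoˡ-< (suc dy) m<E ⟩
    suc e ℕ.* suc dy  ≡⟨ ℕP.*-comm (suc e) (suc dy) ⟩
    suc dy ℕ.* suc e  ∎)
*-fromℕ⇒<1 (mkℚ -[1+ a ] dy _) _ _ =
  ℚ.*<* (subst₂ ℤ._<_ (sym (ℤP.*-identityʳ -[1+ a ])) (sym (ℤP.*-identityˡ (+ suc dy))) ℤ.-<+)

0<m<p⇒p∤m : ∀ {p m} → 0 < m → m < p → ¬ p ∣ m
0<m<p⇒p∤m {m = suc _} _ m<p p∣m = ℕP.<⇒≱ m<p (∣⇒≤ p∣m)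

digitSearch-∈ : ∀ {p i d k} ks → k ∈ ks → p ∣ ℤ.∣ i ℤ.- + k ℤ.* + d ∣ →
  digitSearch p i d ks ∈ ks × p ∣ ℤ.∣ i ℤ.- + digitSearch p i d ks ℤ.* + d ∣
digitSearch-∈ {p} {i} {d} (k′ ∷ ks) k∈ p∣ with p ∣? ℤ.∣ i ℤ.- + k′ ℤ.* + d ∣
... | yes p∣′ = here refl , p∣′
... | no  p∤′ with k∈
...   | here refl = ⊥-elim (p∤′ p∣)
...   | there k∈ks = map₁ there (digitSearch-∈ ks k∈ks p∣)

∣-n-k*d∣ : ∀ n k d → ℤ.∣ ℤ.- (+ n) ℤ.- + k ℤ.* + d ∣ ≡ n ℕ.+ k ℕ.* d
∣-n-k*d∣ n k d = begin
  ℤ.∣ ℤ.- (+ n) ℤ.+ ℤ.- (+ k ℤ.* + d) ∣   ≡⟨ cong ℤ.∣_∣ (ℤP.neg-distrib-+ (+ n) (+ k ℤ.* + d)) ⟨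
  ℤ.∣ ℤ.- (+ n ℤ.+ + k ℤ.* + d) ∣         ≡⟨ ℤP.∣-i∣≡∣i∣ (+ n ℤ.+ + k ℤ.* + d) ⟩
  ℤ.∣ + n ℤ.+ + k ℤ.* + d ∣               ≡⟨ cong (λ z → ℤ.∣ + n ℤ.+ z ∣) (ℤP.pos-* k d) ⟨
  ℤ.∣ + n ℤ.+ + (k ℕ.* d) ∣               ≡⟨ cong ℤ.∣_∣ (ℤP.pos-+ n (k ℕ.* d)) ⟨
  n ℕ.+ k ℕ.* d                           ∎
  where open ≡-Reasoning

∣n+k*d⇒∣n+k%p*d : ∀ {p} n k d .{{_ : ℕ.NonZero p}} → p ∣ n ℕ.+ k ℕ.* d → p ∣ n ℕ.+ (k % p) ℕ.* d
∣n+k*d⇒∣n+k%p*d {p} n k d p∣ =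
  ∣m+n∣m⇒∣n (subst (p ∣_) split p∣) (divides ((k / p) ℕ.* d) (regroup (k / p) p d))
  where
  shuffle : ∀ n r q p d → n ℕ.+ (r ℕ.+ q ℕ.* p) ℕ.* d ≡ q ℕ.* p ℕ.* d ℕ.+ (n ℕ.+ r ℕ.* d)
  shuffle = ℕSolver.solve-∀
  split : n ℕ.+ k ℕ.* d ≡ (k / p) ℕ.* p ℕ.* d ℕ.+ (n ℕ.+ (k % p) ℕ.* d)
  split = begin
    n ℕ.+ k ℕ.* d                                  ≡⟨ cong (λ z → n ℕ.+ z ℕ.* d) (m≡m%n+[m/n]*n k p) ⟩
    n ℕ.+ (k % p ℕ.+ (k / p) ℕ.* p) ℕ.* d          ≡⟨ shuffle n (k % p) (k / p) p d ⟩
    (k / p) ℕ.* p ℕ.* d ℕ.+ (n ℕ.+ (k % p) ℕ.* d)  ∎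
    where open ≡-Reasoning
  regroup : ∀ q p d → q ℕ.* p ℕ.* d ≡ q ℕ.* d ℕ.* p
  regroup = ℕSolver.solve-∀

quotient-≤ : ∀ {p n k e m} → n ≤ p → k < p → n ℕ.+ k ℕ.* suc e ≡ m ℕ.* p → m ≤ suc e
quotient-≤ {p} {n} {k} {e} {m} n≤p k<p eq = ℕP.≤-pred (ℕP.*-cancelʳ-< p m (suc (suc e)) (begin-strict
  m ℕ.* p                      ≡⟨ eq ⟨
  n ℕ.+ k ℕ.* suc e            <⟨ ℕP.m<m+n (n ℕ.+ k ℕ.* suc e) (s≤s z≤n) ⟩
  n ℕ.+ k ℕ.* suc e ℕ.+ suc e  ≡⟨ shuffle n k (suc e) ⟩
  n ℕ.+ suc k ℕ.* suc e        ≤⟨ ℕP.+-mono-≤ n≤p (ℕP.*-monoˡ-≤ (suc e) k<p) ⟩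
  p ℕ.+ p ℕ.* suc e            ≡⟨ cong (p ℕ.+_) (ℕP.*-comm p (suc e)) ⟩
  p ℕ.+ suc e ℕ.* p            ≡⟨⟩
  suc (suc e) ℕ.* p            ∎))
  where
  open ℕP.≤-Reasoning
  shuffle : ∀ n k e → n ℕ.+ k ℕ.* e ℕ.+ e ≡ n ℕ.+ (e ℕ.+ k ℕ.* e)
  shuffle = ℕSolver.solve-∀

quotient-pos : ∀ {n k e m p} → 0 < n → n ℕ.+ k ℕ.* e ≡ m ℕ.* p → 0 < m
quotient-pos {m = suc _} _ _ = s≤s z≤n
quotient-pos {suc _} {m = zero} _ ()

quotient-≡⇒∣ : ∀ {n k e p} → n ℕ.+ k ℕ.* e ≡ e ℕ.* p → e ∣ n
quotient-≡⇒∣ {n} {k} {e} {p} eq =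
  ∣m+n∣m⇒∣n (subst (e ∣_) (trans (sym eq) (ℕP.+-comm n (k ℕ.* e))) (m∣m*n p)) (n∣m*n k)

<⇒≤ᵇ≡false : ∀ {x y} → x ℚ.< y → (y ℚ.≤ᵇ x) ≡ false
<⇒≤ᵇ≡false {x} {y} x<y with y ℚ.≤ᵇ x in y≤ᵇx
... | true  = ⊥-elim (ℚP.<-irrefl refl (ℚP.<-≤-trans x<y (ℚP.≤ᵇ⇒≤ (subst T (sym y≤ᵇx) tt))))
... | false = refl

insertBy-All : ∀ {P : ℚ → Set} {n} f {x} (ys : Vec ℚ n) → P x → All P ys → All P (insertBy f x ys)
insertBy-All f []       px []         = px ∷ []
insertBy-All f {x} (y ∷ ys) px (py ∷ pys) with f x ℚ.≤ᵇ f y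
... | true  = px ∷ py ∷ pys
... | false = py ∷ insertBy-All f ys px pys

sortBy-All : ∀ {P : ℚ → Set} {n} f (xs : Vec ℚ n) → All P xs → All P (sortBy f xs)
sortBy-All f []       []         = []
sortBy-All f (x ∷ xs) (px ∷ pxs) = insertBy-All f (sortBy f xs) px (sortBy-All f xs pxs)

insertBy-above : ∀ f {x n} (ys : Vec ℚ n) → All (λ y → f y ℚ.< f x) ys → insertBy f x ys ≡ ys ∷ʳ x
insertBy-above f []       []           = refl
insertBy-above f (y ∷ ys) (fy<fx ∷ above) rewrite <⇒≤ᵇ≡false fy<fx = cong (y ∷_) (insertBy-above f ys above)

insertBy-above-∷ʳ : ∀ f {x n} (ys : Vec ℚ n) → All (λ y → f y ℚ.< f x) ys →
  insertBy f x (ys ∷ʳ x) ≡ (ys ∷ʳ x) ∷ʳ x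
insertBy-above-∷ʳ f {x} [] [] with f x ℚ.≤ᵇ f x | ℚP.≤⇒≤ᵇ (ℚP.≤-refl {f x})
... | true | _ = refl
insertBy-above-∷ʳ f (y ∷ ys) (fy<fx ∷ above) rewrite <⇒≤ᵇ≡false fy<fx =
  cong (y ∷_) (insertBy-above-∷ʳ f ys above)

sortBy-max-pair : ∀ f t {n} (zs : Vec ℚ n) → All (λ z → f z ℚ.< f t) zs →
  sortBy f (t ∷ t ∷ zs) ≡ (sortBy f zs ∷ʳ t) ∷ʳ t
sortBy-max-pair f t zs below = begin
  insertBy f t (insertBy f t (sortBy f zs))  ≡⟨ cong (insertBy f t) (insertBy-above f (sortBy f zs) below′) ⟩
  insertBy f t (sortBy f zs ∷ʳ t)            ≡⟨ insertBy-above-∷ʳ f (sortBy f zs) below′ ⟩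
  (sortBy f zs ∷ʳ t) ∷ʳ t                    ∎
  where
  open ≡-Reasoning
  below′ : All (λ z → f z ℚ.< f t) (sortBy f zs)
  below′ = sortBy-All f zs below

lookup-∷ʳ-∷ʳ : ∀ {A : Set} (ws : Vec A 2) x y →
  lookup ((ws ∷ʳ x) ∷ʳ y) (suc (suc zero)) ≡ x × lookup ((ws ∷ʳ x) ∷ʳ y) (suc (suc (suc zero))) ≡ y
lookup-∷ʳ-∷ʳ (_ ∷ _ ∷ []) x y = refl , refl

module pAdic {p : ℕ} (p-prime : Prime p) where

  private instance
    p≢0 : ℕ.NonZero p
    p≢0 = prime⇒nonZero p-prime

  record Integral (x : ℚ) : Set where
    constructor integral
    field
      num den : ℤ
      p∤den : ¬ p ∣ ℤ.∣ den ∣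
      x*den≡num : x * fromℤ den ≡ fromℤ num

  record Unit (x : ℚ) : Set where
    constructor unit
    field
      toIntegral : Integral x
      p∤num : ¬ p ∣ ℤ.∣ Integral.num toIntegral ∣

  open Unit using (toIntegral)

  p∤1 : ¬ p ∣ 1
  p∤1 p∣1 = ¬prime[1] (subst Prime (∣1⇒≡1 p∣1) p-prime)

  p∤* : ∀ {i j} → ¬ p ∣ ℤ.∣ i ∣ → ¬ p ∣ ℤ.∣ j ∣ → ¬ p ∣ ℤ.∣ i ℤ.* j ∣
  p∤* {i} {j} p∤i p∤j p∣ij =
    [ p∤i , p∤j ]′ (euclidsLemma ℤ.∣ i ∣ ℤ.∣ j ∣ p-prime (subst (p ∣_) (ℤP.abs-* i j) p∣ij))

  integral⇒InZp : ∀ {x} → Integral x → InZp p x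
  integral⇒InZp {x@(mkℚ _ _ c)} (integral n d p∤d eq) p∣↧x = p∤d (∣-trans p∣↧x ↧x∣d)
    where
    ↧x∣d : ↧ₙ x ∣ ℤ.∣ d ∣
    ↧x∣d = Coprimality.coprime-divisor (Coprimality.sym (Coprimality.recompute c))
             (divides ℤ.∣ n ∣ (*-fromℤ⇒cross x {n} {d} eq))

  InZp⇒¬InPZp⇒unit : ∀ {x} → InZp p x → ¬ InPZp p x → Unit x
  InZp⇒¬InPZp⇒unit {x} p∤↧x p∤↥x = unit (integral (↥ x) (ℚ.↧ x) p∤↧x (*-denominator x)) p∤↥x

  integral-fromℤ : ∀ n → Integral (fromℤ n)
  integral-fromℤ n = integral n (+ 1) p∤1 (ℚP.*-identityʳ (fromℤ n))

  unit-1 : Unit 1ℚ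
  unit-1 = unit (integral-fromℤ (+ 1)) p∤1

  integral-* : ∀ {x y} → Integral x → Integral y → Integral (x * y)
  integral-* {x} {y} (integral n₁ d₁ p∤d₁ eq₁) (integral n₂ d₂ p∤d₂ eq₂) =
    integral (n₁ ℤ.* n₂) (d₁ ℤ.* d₂) (p∤* {d₁} p∤d₁ p∤d₂) (begin
      (x * y) * fromℤ (d₁ ℤ.* d₂)        ≡⟨ cong ((x * y) *_) (fromℤ-* d₁ d₂) ⟩
      (x * y) * (fromℤ d₁ * fromℤ d₂)    ≡⟨ ℚ*.interchange x y _ _ ⟩
      (x * fromℤ d₁) * (y * fromℤ d₂)    ≡⟨ cong₂ _*_ eq₁ eq₂ ⟩
      fromℤ n₁ * fromℤ n₂                ≡⟨ fromℤ-* n₁ n₂ ⟨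
      fromℤ (n₁ ℤ.* n₂)                  ∎)
    where open ≡-Reasoning

  unit-* : ∀ {x y} → Unit x → Unit y → Unit (x * y)
  unit-* (unit i₁ p∤n₁) (unit i₂ p∤n₂) =
    unit (integral-* i₁ i₂) (p∤* {Integral.num i₁} p∤n₁ p∤n₂)

  integral-+ : ∀ {x y} → Integral x → Integral y → Integral (x + y)
  integral-+ {x} {y} (integral n₁ d₁ p∤d₁ eq₁) (integral n₂ d₂ p∤d₂ eq₂) =
    integral (n₁ ℤ.* d₂ ℤ.+ n₂ ℤ.* d₁) (d₁ ℤ.* d₂) (p∤* {d₁} p∤d₁ p∤d₂) (begin
      (x + y) * fromℤ (d₁ ℤ.* d₂)                              ≡⟨ cong ((x + y) *_) (fromℤ-* d₁ d₂) ⟩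
      (x + y) * (fromℤ d₁ * fromℤ d₂)                          ≡⟨ ℚP.*-distribʳ-+ _ x y ⟩
      x * (fromℤ d₁ * fromℤ d₂) + y * (fromℤ d₁ * fromℤ d₂)    ≡⟨ cong₂ _+_ (ℚP.*-assoc x _ _) (ℚ*.xy∙z≈x∙zy y _ _) ⟨
      (x * fromℤ d₁) * fromℤ d₂ + (y * fromℤ d₂) * fromℤ d₁    ≡⟨ cong₂ (λ u v → u * fromℤ d₂ + v * fromℤ d₁) eq₁ eq₂ ⟩
      fromℤ n₁ * fromℤ d₂ + fromℤ n₂ * fromℤ d₁                ≡⟨ cong₂ _+_ (fromℤ-* n₁ d₂) (fromℤ-* n₂ d₁) ⟨
      fromℤ (n₁ ℤ.* d₂) + fromℤ (n₂ ℤ.* d₁)                    ≡⟨ fromℤ-+ (n₁ ℤ.* d₂) (n₂ ℤ.* d₁) ⟨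
      fromℤ (n₁ ℤ.* d₂ ℤ.+ n₂ ℤ.* d₁)                          ∎)
    where open ≡-Reasoning

  integral-pow : ∀ {x} n → Integral x → Integral (pow x n)
  integral-pow zero    _ = integral-fromℤ (+ 1)
  integral-pow (suc n) i = integral-* i (integral-pow n i)

  unit-pow : ∀ {x} n → Unit x → Unit (pow x n)
  unit-pow zero    _ = unit-1
  unit-pow (suc n) u = unit-* u (unit-pow n u)

  unit⇒≢0 : ∀ {x} → Unit x → x ≢ 0ℚ
  unit⇒≢0 (unit (integral n d _ eq) p∤n) refl =
    p∤n (subst (λ n → p ∣ ℤ.∣ n ∣) n≡0 (p ∣0))
    where
    n≡0 : + 0 ≡ n
    n≡0 = fromℤ-injective {+ 0} {n} (trans (sym (ℚP.*-zeroˡ (fromℤ d))) eq)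

  unit-inv : ∀ {x} → Unit x → Unit (inv x)
  unit-inv {x} u@(unit (integral n d p∤d eq) p∤n) = unit (integral d n p∤n (begin
      inv x * fromℤ n            ≡⟨ cong (inv x *_) eq ⟨
      inv x * (x * fromℤ d)      ≡⟨ ℚP.*-assoc (inv x) x (fromℤ d) ⟨
      (inv x * x) * fromℤ d      ≡⟨ cong (_* fromℤ d) (trans (ℚP.*-comm (inv x) x) (*-inv (unit⇒≢0 u))) ⟩
      1ℚ * fromℤ d               ≡⟨ ℚP.*-identityˡ (fromℤ d) ⟩
      fromℤ d                    ∎)) p∤d
    where open ≡-Reasoning

  integral-onePlus : ∀ b {y} → Unit y → Integral (onePlus b y)
  integral-onePlus b u =
    integral-+ (integral-fromℤ (+ 1)) (integral-* (integral-fromℤ (+ b)) (toIntegral (unit-inv u)))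

  unit-onePlus : ∀ b {y} → Unit y → ¬ InPZp p (fromℕ b + y) → Unit (onePlus b y)
  unit-onePlus b {y} u p∤b+y = subst Unit (sym onePlus≡) (unit-* b+y-unit (unit-inv u))
    where
    b+y-unit : Unit (fromℕ b + y)
    b+y-unit = InZp⇒¬InPZp⇒unit
      (integral⇒InZp (integral-+ (integral-fromℤ (+ b)) (toIntegral u))) p∤b+y
    onePlus≡ : onePlus b y ≡ (fromℕ b + y) * inv y
    onePlus≡ = begin
      1ℚ + fromℕ b * inv y              ≡⟨ ℚP.+-comm 1ℚ (fromℕ b * inv y) ⟩
      fromℕ b * inv y + 1ℚ              ≡⟨ cong (λ z → fromℕ b * inv y + z) (*-inv (unit⇒≢0 u)) ⟨
      fromℕ b * inv y + y * inv y       ≡⟨ ℚP.*-distribʳ-+ (inv y) (fromℕ b) y ⟨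
      (fromℕ b + y) * inv y             ∎
      where open ≡-Reasoning

  ν-≤ : ∀ {a u} → a ≤ u → ν a u ≡ 0
  ν-≤ {a} {u} a≤u with a ℕ.≤ᵇ u | ℕP.≤⇒≤ᵇ a≤u
  ... | true | _ = refl

  integral-inv-pow-ν : ∀ {a u} y → a ≤ u → Integral (inv (pow y (ν a u)))
  integral-inv-pow-ν y a≤u =
    subst (λ n → Integral (inv (pow y n))) (sym (ν-≤ a≤u)) (integral-fromℤ (+ 1))

  integral-inv-pow : ∀ {y} n → Unit y → Integral (inv (pow y n))
  integral-inv-pow n u = toIntegral (unit-inv (unit-pow n u))

  integral-*-inv : ∀ y → Integral (y * inv y)
  integral-*-inv y with y ℚP.≟ 0ℚ
  ... | yes refl = integral-fromℤ (+ 0)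
  ... | no  y≢0  = subst Integral (sym (ℚP.*-inverseʳ y {{ℚ.≢-nonZero y≢0}})) (integral-fromℤ (+ 1))

  integral-*-inv-pow-ν : ∀ a u {y} → Integral y → Integral (y * inv (pow y (ν a u)))
  integral-*-inv-pow-ν a u {y} i with a ℕ.≤ᵇ u
  ... | true  = subst Integral (sym (ℚP.*-identityʳ y)) i
  ... | false rewrite ℚP.*-identityʳ y = integral-*-inv y

  prime-∤⇒coprime : ∀ {d} → ¬ p ∣ d → Coprime p d
  prime-∤⇒coprime p∤d (c∣p , c∣d) with prime⇒irreducible p-prime c∣p
  ... | inj₁ c≡1  = c≡1
  ... | inj₂ refl = ⊥-elim (p∤d c∣d)

  -- Bézout inverts d modulo p; in the second case −1 is represented by p′ = p − 1.
  solvable : ∀ n {d} → ¬ p ∣ d → ∃[ K ] p ∣ n ℕ.+ K ℕ.* d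
  solvable n {d} p∤d with Coprimality.coprime-Bézout (prime-∤⇒coprime p∤d)
  ... | Bézout.+- x y eq = n ℕ.* y , divides (n ℕ.* x) (begin
      n ℕ.+ n ℕ.* y ℕ.* d       ≡⟨ distrib n y d ⟩
      n ℕ.* (1 ℕ.+ y ℕ.* d)     ≡⟨ cong (n ℕ.*_) eq ⟩
      n ℕ.* (x ℕ.* p)           ≡⟨ ℕP.*-assoc n x p ⟨
      n ℕ.* x ℕ.* p             ∎)
    where
    open ≡-Reasoning
    distrib : ∀ n y d → n ℕ.+ n ℕ.* y ℕ.* d ≡ n ℕ.* (1 ℕ.+ y ℕ.* d)
    distrib = ℕSolver.solve-∀
  ... | Bézout.-+ x y eq = n ℕ.* p′ ℕ.* y , divides (n ℕ.+ n ℕ.* p′ ℕ.* x) (begin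
      n ℕ.+ n ℕ.* p′ ℕ.* y ℕ.* d          ≡⟨ reassoc n p′ y d ⟩
      n ℕ.+ n ℕ.* p′ ℕ.* (y ℕ.* d)        ≡⟨ cong (λ z → n ℕ.+ n ℕ.* p′ ℕ.* z) eq ⟨
      n ℕ.+ n ℕ.* p′ ℕ.* (1 ℕ.+ x ℕ.* p)  ≡⟨ collect ⟩
      (n ℕ.+ n ℕ.* p′ ℕ.* x) ℕ.* p        ∎)
    where
    open ≡-Reasoning
    p′ : ℕ
    p′ = ℕ.pred p
    reassoc : ∀ n p′ y d → n ℕ.+ n ℕ.* p′ ℕ.* y ℕ.* d ≡ n ℕ.+ n ℕ.* p′ ℕ.* (y ℕ.* d)
    reassoc = ℕSolver.solve-∀
    collect-suc : ∀ n q x → n ℕ.+ n ℕ.* q ℕ.* (1 ℕ.+ x ℕ.* suc q) ≡ (n ℕ.+ n ℕ.* q ℕ.* x) ℕ.* suc q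
    collect-suc = ℕSolver.solve-∀
    collect : n ℕ.+ n ℕ.* p′ ℕ.* (1 ℕ.+ x ℕ.* p) ≡ (n ℕ.+ n ℕ.* p′ ℕ.* x) ℕ.* p
    collect = subst (λ q → n ℕ.+ n ℕ.* p′ ℕ.* (1 ℕ.+ x ℕ.* q) ≡ (n ℕ.+ n ℕ.* p′ ℕ.* x) ℕ.* q)
                    (ℕP.suc-pred p) (collect-suc n p′ x)

  digit-exists : ∀ n {d} → ¬ p ∣ d → ∃[ k ] k < p × p ∣ n ℕ.+ k ℕ.* d
  digit-exists n {d} p∤d = reduce (solvable n p∤d)
    where
    reduce : ∃[ K ] p ∣ n ℕ.+ K ℕ.* d → ∃[ k ] k < p × p ∣ n ℕ.+ k ℕ.* d
    reduce (K , p∣) = K % p , m%n<n K p , ∣n+k*d⇒∣n+k%p*d n K d p∣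

  digit0-spec : ∀ n d .(c : Coprime (suc n) (suc d)) → ¬ p ∣ suc d →
    let k = digit0 p (ℚ.- (mkℚ +[1+ n ] d c)) in k < p × p ∣ suc n ℕ.+ k ℕ.* suc d
  digit0-spec n d c p∤D = searched (digit-exists (suc n) p∤D)
    where
    k : ℕ
    k = digit0 p (ℚ.- (mkℚ +[1+ n ] d c))
    searched : ∃[ k′ ] k′ < p × p ∣ suc n ℕ.+ k′ ℕ.* suc d → k < p × p ∣ suc n ℕ.+ k ℕ.* suc d
    searched (k′ , k′<p , p∣) =
      map ∈-upTo⁻ (subst (p ∣_) (∣-n-k*d∣ (suc n) k (suc d)))
          (digitSearch-∈ (upTo p) (∈-upTo⁺ k′<p) (subst (p ∣_) (sym (∣-n-k*d∣ (suc n) k′ (suc d))) p∣))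

  dash-*-denominator : ∀ n d .(c : Coprime (suc n) (suc d)) {m} →
    suc n ℕ.+ digit0 p (ℚ.- (mkℚ +[1+ n ] d c)) ℕ.* suc d ≡ m ℕ.* p →
    dash p (mkℚ +[1+ n ] d c) * fromℕ (suc d) ≡ fromℕ m
  dash-*-denominator n d c {m} eq = begin
    ((x + K) * R) * D                           ≡⟨ ℚ*.xy∙z≈xz∙y (x + K) R D ⟩
    ((x + K) * D) * R                           ≡⟨ cong (_* R) (ℚP.*-distribʳ-+ D x K) ⟩
    (x * D + K * D) * R                         ≡⟨ cong (λ z → (z + K * D) * R) (*-denominator x) ⟩
    (fromℕ (suc n) + K * D) * R                 ≡⟨ cong (λ z → (fromℕ (suc n) + z) * R) (fromℕ-* k (suc d)) ⟨
    (fromℕ (suc n) + fromℕ (k ℕ.* suc d)) * R   ≡⟨ cong (_* R) (fromℤ-+ (+ suc n) (+ (k ℕ.* suc d))) ⟨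
    fromℕ (suc n ℕ.+ k ℕ.* suc d) * R           ≡⟨ cong (λ z → fromℕ z * R) eq ⟩
    fromℕ (m ℕ.* p) * R                         ≡⟨ cong (_* R) (fromℕ-* m p) ⟩
    (fromℕ m * fromℕ p) * R                     ≡⟨ ℚP.*-assoc (fromℕ m) (fromℕ p) R ⟩
    fromℕ m * (fromℕ p * R)                     ≡⟨ cong (fromℕ m *_) (fromℕ*recipℕ p) ⟩
    fromℕ m * 1ℚ                                ≡⟨ ℚP.*-identityʳ (fromℕ m) ⟩
    fromℕ m                                     ∎
    where
    open ≡-Reasoning
    x K R D : ℚ
    k : ℕ
    x = mkℚ +[1+ n ] d c
    k = digit0 p (ℚ.- x)
    K = fromℕ k
    R = recipℕ p
    D = fromℕ (suc d)

  dash-as-fraction : ∀ n d .(c : Coprime (suc n) (suc d)) → suc n ≤ p → suc d < p →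
    BoundedFraction (dash p (mkℚ +[1+ n ] d c)) (suc d)
  dash-as-fraction n d c n≤p d<p = from-digit (digit0-spec n d c (0<m<p⇒p∤m (s≤s z≤n) d<p))
    where
    k : ℕ
    k = digit0 p (ℚ.- (mkℚ +[1+ n ] d c))
    from-digit : k < p × p ∣ suc n ℕ.+ k ℕ.* suc d → BoundedFraction (dash p (mkℚ +[1+ n ] d c)) (suc d)
    from-digit (k<p , divides m eq) =
      m , dash-*-denominator n d c {m} eq , quotient-pos {suc n} {k} (s≤s z≤n) eq ,
      quotient-≤ {p} {suc n} {k} n≤p k<p eq ,
      λ { refl → Coprimality.recompute c (quotient-≡⇒∣ {suc n} {k} eq , ∣-refl) }

  dash-unit : ∀ x → + 1 ℤ.≤ ↥ x → ↥ x ℤ.≤ + p → ↧ₙ x < p → Unit (dash p x)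
  dash-unit (mkℚ +[1+ n ] d c) _ (ℤ.+≤+ n≤p) d<p =
    let m , eq , 0<m , m≤d , _ = dash-as-fraction n d c n≤p d<p in
    unit (integral (+ m) (+ suc d) (0<m<p⇒p∤m (s≤s z≤n) d<p) eq) (0<m<p⇒p∤m 0<m (ℕP.≤-<-trans m≤d d<p))
  dash-unit (mkℚ (+ 0) _ _) (ℤ.+≤+ ()) _ _
  dash-unit (mkℚ -[1+ _ ] _ _) () _ _

  dash-<1 : ∀ x → + 1 ℤ.≤ ↥ x → ↥ x ℤ.≤ + p → ↧ₙ x < p → 1 < ↧ₙ x → dash p x ℚ.< 1ℚ
  dash-<1 (mkℚ +[1+ n ] (suc d) c) _ (ℤ.+≤+ n≤p) d<p _ =
    let m , eq , _ , m≤d , whole = dash-as-fraction n (suc d) c n≤p d<p in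
    *-fromℕ⇒<1 (dash p (mkℚ +[1+ n ] (suc d) c)) eq (ℕP.≤∧≢⇒< m≤d (λ m≡d → case whole m≡d of λ ()))
  dash-<1 (mkℚ +[1+ n ] zero _) _ _ _ (s≤s ())
  dash-<1 (mkℚ (+ 0) _ _) (ℤ.+≤+ ()) _ _ _
  dash-<1 (mkℚ -[1+ _ ] _ _) () _ _ _

  dash-1 : dash p 1ℚ ≡ 1ℚ
  dash-1 =
    let 1<p = ℕ.nonTrivial⇒n>1 p {{prime⇒nonTrivial p-prime}}
        m , eq , 0<m , m≤1 , _ = dash-as-fraction 0 0 (Coprimality.1-coprimeTo 1) (ℕP.<⇒≤ 1<p) 1<p in
    trans (sym (ℚP.*-identityʳ (dash p 1ℚ))) (trans eq (cong fromℕ (ℕP.≤-antisym m≤1 0<m)))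

  ≤-digit0-neg-1 : ∀ {a} → a < p → a ≤ digit0 p (ℚ.- 1ℚ)
  ≤-digit0-neg-1 {a} a<p =
    let _ , p∣1+k = digit0-spec 0 0 (Coprimality.1-coprimeTo 1) p∤1 in
    subst (a ≤_) (ℕP.*-identityʳ _) (ℕP.≤-pred (ℕP.<-≤-trans a<p (∣⇒≤ p∣1+k)))

  ≤-u-of-q≡1 : ∀ {a} D j → a < p → q_ p D j ≡ 1ℚ → a ≤ u_ p D j
  ≤-u-of-q≡1 {a} D j a<p q≡1 = subst (λ z → a ≤ digit0 p (ℚ.- z)) (sym q≡1) (≤-digit0-neg-1 a<p)

  -- Fin indices are 0-based: zero labels q₁ and suc zero labels q₂.
  integral-onePlus-Λ : ∀ D a b →
    (∀ j → Unit (dash p (r_ p D j))) → (∀ j → Unit (dash p (q_ p D j))) →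
    a ≤ u_ p D (suc (suc zero)) → a ≤ u_ p D (suc (suc (suc zero))) →
    (a ≤ u_ p D (suc zero) ⊎ ¬ InPZp p (fromℕ b + dash p (q_ p D (suc zero)))) →
    Integral (onePlus b (dash p (q_ p D zero)) * Λ p D a b)
  integral-onePlus-Λ D a b r′-unit q′-unit a≤u₃ a≤u₄ a≤u₂⊎unit =
    subst Integral regroup
      (integral-* (integral-* (r-part-integral zero) X*q-part₁-integral)
                  (integral-* (factor-integral (suc zero) q-part₂-integral)
                              (integral-* (factor-integral (suc (suc zero)) (integral-inv-pow-ν _ a≤u₃))
                                          (factor-integral (suc (suc (suc zero))) (integral-inv-pow-ν _ a≤u₄)))))
    where
    r-part q-part : Fin 4 → ℚ
    r-part j = pow (onePlus b (dash p (r_ p D j))) (ν a (t_ p D j))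
    q-part j = inv (pow (onePlus b (dash p (q_ p D j))) (ν a (u_ p D j)))
    X rest : ℚ
    X = onePlus b (dash p (q_ p D zero))
    rest = Λfactor p D a b (suc zero)
         * (Λfactor p D a b (suc (suc zero)) * Λfactor p D a b (suc (suc (suc zero))))

    r-part-integral : ∀ j → Integral (r-part j)
    r-part-integral j = integral-pow (ν a (t_ p D j)) (integral-onePlus b (r′-unit j))

    factor-integral : ∀ j → Integral (q-part j) → Integral (Λfactor p D a b j)
    factor-integral j = integral-* (r-part-integral j)

    X*q-part₁-integral : Integral (X * q-part zero)
    X*q-part₁-integral = integral-*-inv-pow-ν a (u_ p D zero) (integral-onePlus b (q′-unit zero))

    q-part₂-integral : Integral (q-part (suc zero))
    q-part₂-integral =
      [ integral-inv-pow-ν _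
      , (λ p∤ → integral-inv-pow (ν a (u_ p D (suc zero))) (unit-onePlus b (q′-unit (suc zero)) p∤))
      ]′ a≤u₂⊎unit

    regroup : (r-part zero * (X * q-part zero)) * rest ≡ X * ((r-part zero * q-part zero) * rest)
    regroup = begin
      (r-part zero * (X * q-part zero)) * rest   ≡⟨ cong (_* rest) (ℚ*.x∙yz≈y∙xz (r-part zero) X (q-part zero)) ⟩
      (X * (r-part zero * q-part zero)) * rest   ≡⟨ ℚP.*-assoc X _ rest ⟩
      X * ((r-part zero * q-part zero) * rest)   ∎
      where open ≡-Reasoning

SmallFraction : ℚ → Set
SmallFraction x = + 1 ℤ.≤ ↥ x × ↥ x ℤ.≤ + 7 × ↧ₙ x ≤ 6

smallFraction? : ∀ x → Dec (SmallFraction x)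
smallFraction? x = (+ 1 ℤP.≤? ↥ x) ×-dec (↥ x ℤP.≤? + 7) ×-dec (↧ₙ x ℕP.≤? 6)

q-pair : Datum → Vec ℚ 2
q-pair D = qOf D ∷ (fromℕ 2 ℚ.- qOf D) ∷ []

Admissible : Datum → Set
Admissible D = All SmallFraction (alpha D) × All SmallFraction (beta D) × All (λ z → 1 < ↧ₙ z) (q-pair D)

admissible? : ∀ D → Dec (Admissible D)
admissible? D =
  all? smallFraction? (alpha D) ×-dec all? smallFraction? (beta D) ×-dec all? (λ z → 1 ℕP.<? ↧ₙ z) (q-pair D)

admissible : ∀ D → Admissible D
admissible d1 = toWitness {a? = admissible? d1} _
admissible d2 = toWitness {a? = admissible? d2} _
admissible d3 = toWitness {a? = admissible? d3} _
admissible d4 = toWitness {a? = admissible? d4} _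
admissible d5 = toWitness {a? = admissible? d5} _
admissible d6 = toWitness {a? = admissible? d6} _

module _ {p : ℕ} (p-prime : Prime p) (7≤p : 7 ≤ p) where
  open pAdic p-prime

  small-dash-unit : ∀ {x} → SmallFraction x → Unit (dash p x)
  small-dash-unit {x} (1≤n , n≤7 , d≤6) =
    dash-unit x 1≤n (ℤP.≤-trans n≤7 (ℤ.+≤+ 7≤p)) (ℕP.<-≤-trans (s≤s d≤6) 7≤p)

  sorted-dash-unit : ∀ {n} (xs : Vec ℚ n) → All SmallFraction xs →
    ∀ j → Unit (dash p (lookup (sortBy (dash p) xs) j))
  sorted-dash-unit xs small =
    lookup⁺ (sortBy-All {P = λ x → Unit (dash p x)} (dash p) xs
      (All.map (λ {x} → small-dash-unit {x}) small))

  small-dash-<-dash-1 : ∀ x → SmallFraction x → 1 < ↧ₙ x → dash p x ℚ.< dash p 1ℚ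
  small-dash-<-dash-1 x (1≤n , n≤7 , d≤6) 1<d = subst (dash p x ℚ.<_) (sym dash-1)
    (dash-<1 x 1≤n (ℤP.≤-trans n≤7 (ℤ.+≤+ 7≤p)) (ℕP.<-≤-trans (s≤s d≤6) 7≤p) 1<d)

  q₃≡1×q₄≡1 : ∀ D → All SmallFraction (beta D) → All (λ z → 1 < ↧ₙ z) (q-pair D) →
    q_ p D (suc (suc zero)) ≡ 1ℚ × q_ p D (suc (suc (suc zero))) ≡ 1ℚ
  q₃≡1×q₄≡1 D (_ ∷ _ ∷ small₁ ∷ small₂ ∷ []) (1<d₁ ∷ 1<d₂ ∷ []) =
    trans (cong (λ v → lookup v (suc (suc zero))) sorted) (proj₁ (lookup-∷ʳ-∷ʳ ws 1ℚ 1ℚ)) ,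
    trans (cong (λ v → lookup v (suc (suc (suc zero)))) sorted) (proj₂ (lookup-∷ʳ-∷ʳ ws 1ℚ 1ℚ))
    where
    ws : Vec ℚ 2
    ws = sortBy (dash p) (q-pair D)
    sorted : sortBy (dash p) (beta D) ≡ (ws ∷ʳ 1ℚ) ∷ʳ 1ℚ
    sorted = sortBy-max-pair (dash p) 1ℚ (q-pair D)
               (small-dash-<-dash-1 (qOf D) small₁ 1<d₁ ∷
                small-dash-<-dash-1 (fromℕ 2 ℚ.- qOf D) small₂ 1<d₂ ∷ [])

lemma4p4 : (p : ℕ) → Prime p → 7 ≤ p → (D : Datum) → (a b : ℕ) → a < p →
  (a ≤ u_ p D (suc zero) ⊎ ¬ InPZp p (fromℕ b + dash p (q_ p D (suc zero)))) →
  InZp p (onePlus b (dash p (q_ p D zero)) * Λ p D a b)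
lemma4p4 p p-prime 7≤p D a b a<p a≤u₂⊎unit =
  integral⇒InZp (integral-onePlus-Λ D a b
    (sorted-dash-unit p-prime 7≤p (alpha D) α-small)
    (sorted-dash-unit p-prime 7≤p (beta D) β-small)
    (≤-u-of-q≡1 {a} D (suc (suc zero)) a<p (proj₁ q₃,q₄≡1))
    (≤-u-of-q≡1 {a} D (suc (suc (suc zero))) a<p (proj₂ q₃,q₄≡1))
    a≤u₂⊎unit)
  where
  open pAdic p-prime
  α-small : All SmallFraction (alpha D)
  α-small = proj₁ (admissible D)
  β-small : All SmallFraction (beta D)
  β-small = proj₁ (proj₂ (admissible D))
  q₃,q₄≡1 : q_ p D (suc (suc zero)) ≡ 1ℚ × q_ p D (suc (suc (suc zero))) ≡ 1ℚ
  q₃,q₄≡1 = q₃≡1×q₄≡1 p-prime 7≤p D β-small (proj₂ (proj₂ (admissible D)))
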